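{- For any pointed graph $(X,x_0)$ there is a group isomorphism $A_1(X,x_0)\cong\Pi_1X(x_0,x_0)$. If $X$ is connected, the inclusion of $\{x_0\}$ into $X$ induces an equivalence of categories between the fundamental group $A_1(X,x_0)$ (viewed as a one-object groupoid) and the fundamental groupoid $\Pi_1X$.
   Context: Graphs are simple undirected loopless graphs; graph maps send adjacent vertices to equal or adjacent vertices. $I_n$ ($n\in\mathbb{N}$) has vertices $0,\dots,n$, edges $i\sim i+1$; $I_\infty$ has vertices $\mathbb{Z}$, edges $i\sim i+1$. A loop of length $\infty$ at $x_0$ is a graph map $\gamma\colon I_\infty\to X$ with integers $N_-,N_+$ such that $\gamma(i)=x_0$ for $i\le N_-$ and $i\ge N_+$; $\Omega_\infty(X,x_0)$ is the graph of these loops, with $\gamma\sim\sigma$ iff $\gamma\ne\sigma$ and $\gamma(i)=\sigma(i)$ or $\gamma(i)\sim\sigma(i)$ for all $i$. $A_1(X,x_0)=\pi_0\Omega_\infty(X,x_0)$ (path-components), with group operation induced by concatenation: $(\gamma\ast\sigma)(i)=\gamma(i)$ for $i\le M_+$ and $\sigma(i-M_++N_-)$ for $i\ge M_+$, where $M_+$ is the least integer with $\gamma(i)=x_0$ for all $i\ge M_+$ and $N_-$ the largest integer with $\sigma(i)=x_0$ for all $i\le N_-$. A path of finite length $n$ from $x$ to $x'$ is a graph map $I_n\to X$ with endpoints $x,x'$; $P_nX(x,x')$ is the graph of such paths, adjacent iff distinct and pointwise equal-or-adjacent; $P_{\mathbb{N}}X(x,x')$ is the quotient of $\coprod_nP_nX(x,x')$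 by the equivalence generated by $\gamma\sim\gamma\circ s$ for surjective order-preserving graph maps $s\colon I_m\to I_n$. The fundamental groupoid $\Pi_1X$ has objects the vertices, $\Pi_1X(x,x')=\pi_0P_{\mathbb{N}}X(x,x')$, composition $[\sigma]\circ[\gamma]=[\gamma\ast\sigma]$ with finite concatenation. Connected means any two vertices are joined by a path. -}

module Defs where

open import Data.Nat as ℕ using (ℕ; zero; suc; _∸_; _≤ᵇ_)
open import Data.Integer as ℤ using (ℤ; _≤_; 1ℤ)
open import Data.Integer.Properties using (_≤?_)
open import Data.Fin using (Fin; zero; suc; inject₁; fromℕ; toℕ)
open import Data.Bool using (if_then_else_)
open import Data.Product using (Σ; Σ-syntax; _×_; _,_; ∃; ∃-syntax)
open import Data.Sum using (_⊎_)
open import Relation.Nullary using (¬_; does)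
open import Relation.Binary.PropositionalEquality using (_≡_; refl)
open import Relation.Binary.Construct.Closure.ReflexiveTransitive using (Star)

record Graph : Set₁ where
  field
    V        : Set
    _~_      : V → V → Set
    ~-sym    : ∀ {x y} → x ~ y → y ~ x
    ~-irrefl : ∀ {x} → ¬ (x ~ x)

module _ (X : Graph) where
  open Graph X

  EqAdj : V → V → Set
  EqAdj x y = x ≡ y ⊎ x ~ y

  record Loop∞ (x₀ : V) : Set where
    field
      γ     : ℤ → V
      map   : ∀ i → EqAdj (γ i) (γ (i ℤ.+ 1ℤ))
      N₋ N₊ : ℤ
      below : ∀ i → i ≤ N₋ → γ i ≡ x₀
      above : ∀ i → N₊ ≤ i → γ i ≡ x₀

  ΩEqAdj : ∀ {x₀} → Loop∞ x₀ → Loop∞ x₀ → Set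
  ΩEqAdj γ σ = ∀ i → EqAdj (Loop∞.γ γ i) (Loop∞.γ σ i)

  -- same path-component of Ω_∞(X,x₀), i.e. equal in A₁(X,x₀) = π₀ Ω_∞(X,x₀)
  SameA₁ : ∀ {x₀} → Loop∞ x₀ → Loop∞ x₀ → Set
  SameA₁ = Star ΩEqAdj

  constLoop : (x₀ : V) → Loop∞ x₀
  constLoop x₀ = record
    { γ = λ _ → x₀ ; map = λ _ → Data.Sum.inj₁ refl
    ; N₋ = ℤ.0ℤ ; N₊ = ℤ.0ℤ ; below = λ _ _ → refl ; above = λ _ _ → refl }

  IsLeastM₊ : ∀ {x₀} → Loop∞ x₀ → ℤ → Set
  IsLeastM₊ {x₀} γ M =
    (∀ i → M ≤ i → Loop∞.γ γ i ≡ x₀) ×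
    (∀ M' → (∀ i → M' ≤ i → Loop∞.γ γ i ≡ x₀) → M ≤ M')

  IsGreatestN₋ : ∀ {x₀} → Loop∞ x₀ → ℤ → Set
  IsGreatestN₋ {x₀} σ N =
    (∀ i → i ≤ N → Loop∞.γ σ i ≡ x₀) ×
    (∀ N' → (∀ i → i ≤ N' → Loop∞.γ σ i ≡ x₀) → N' ≤ N)

  concat∞ : ∀ {x₀} → Loop∞ x₀ → Loop∞ x₀ → ℤ → ℤ → ℤ → V
  concat∞ γ σ M N i =
    if does (i ≤? M) then Loop∞.γ γ i else Loop∞.γ σ (i ℤ.- M ℤ.+ N)

  IsConcat∞ : ∀ {x₀} → Loop∞ x₀ → Loop∞ x₀ → Loop∞ x₀ → Set
  IsConcat∞ γ σ τ = Σ[ M ∈ ℤ ] Σ[ N ∈ ℤ ]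
    IsLeastM₊ γ M × IsGreatestN₋ σ N × (∀ i → Loop∞.γ τ i ≡ concat∞ γ σ M N i)

  record Path (n : ℕ) (x x' : V) : Set where
    field
      p      : Fin (suc n) → V
      map    : ∀ (i : Fin n) → EqAdj (p (inject₁ i)) (p (suc i))
      start  : p zero ≡ x
      finish : p (fromℕ n) ≡ x'

  PathN : V → V → Set
  PathN x x' = Σ[ n ∈ ℕ ] Path n x x'

  PEqAdj : ∀ {x x'} → PathN x x' → PathN x x' → Set
  PEqAdj {x} {x'} (n , γ) (m , σ) =
    Σ[ e ∈ n ≡ m ] Same e γ σ
    where
      Same : n ≡ m → Path n x x' → Path m x x' → Set
      Same refl γ σ = ∀ i → EqAdj (Path.p γ i) (Path.p σ i)

  IsReparam : (m n : ℕ) → (Fin (suc m) → Fin (suc n)) → Set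
  IsReparam m n s =
    (∀ i j → toℕ i ℕ.≤ toℕ j → toℕ (s i) ℕ.≤ toℕ (s j)) ×
    (∀ (i : Fin m) → toℕ (s (inject₁ i)) ≡ toℕ (s (suc i))
                   ⊎ suc (toℕ (s (inject₁ i))) ≡ toℕ (s (suc i))
                   ⊎ toℕ (s (inject₁ i)) ≡ suc (toℕ (s (suc i)))) ×
    (∀ j → ∃[ i ] s i ≡ j)

  Reparam : ∀ {x x'} → PathN x x' → PathN x x' → Set
  Reparam (m , γ') (n , γ) =
    Σ[ s ∈ (Fin (suc m) → Fin (suc n)) ] IsReparam m n s ×
      (∀ i → Path.p γ' i ≡ Path.p γ (s i))

  -- equal-or-adjacent in the quotient graph P_ℕ X(x,x'), on representatives
  PNStep : ∀ {x x'} → PathN x x' → PathN x x' → Set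
  PNStep a b = PEqAdj a b ⊎ Reparam a b ⊎ Reparam b a

  -- equality in Π₁X(x,x') = π₀ P_ℕ X(x,x')
  SameΠ₁ : ∀ {x x'} → PathN x x' → PathN x x' → Set
  SameΠ₁ = Star PNStep

  -- evaluation of a finite path at a natural number (clamped to length)
  clamp : (n : ℕ) → ℕ → Fin (suc n)
  clamp zero    _       = zero
  clamp (suc n) zero    = zero
  clamp (suc n) (suc i) = suc (clamp n i)

  at : ∀ {x x'} → PathN x x' → ℕ → V
  at (n , γ) i = Path.p γ (clamp n i)

  IsConcatFin : ∀ {x x' x''} → PathN x x' → PathN x' x'' → PathN x x'' → Set
  IsConcatFin (n , γ) (m , σ) (k , τ) =
    k ≡ n ℕ.+ m ×
    (∀ i → i ℕ.≤ n ℕ.+ m →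
       at (k , τ) i ≡ (if i ≤ᵇ n then at (n , γ) i else at (m , σ) (i ∸ n)))

  idPath : (x : V) → PathN x x
  idPath x = 0 , record { p = λ _ → x ; map = λ () ; start = refl ; finish = refl }

  -- Group isomorphism A₁(X,x₀) ≅ Π₁X(x₀,x₀), given on representatives
  -- (group law of Π₁X(x₀,x₀): [σ]∘[γ] = [γ ∗ σ])

  record IsGroupIso (x₀ : V) (φ : Loop∞ x₀ → PathN x₀ x₀) : Set where
    field
      resp  : ∀ γ σ → SameA₁ γ σ → SameΠ₁ (φ γ) (φ σ)
      inj   : ∀ γ σ → SameΠ₁ (φ γ) (φ σ) → SameA₁ γ σ
      surj  : ∀ c → ∃[ γ ] SameΠ₁ (φ γ) c
      hom   : ∀ γ σ τ → IsConcat∞ γ σ τ →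
              ∀ c → IsConcatFin (φ γ) (φ σ) c → SameΠ₁ (φ τ) c
      unit  : SameΠ₁ (φ (constLoop x₀)) (idPath x₀)

  Connected : Set
  Connected = ∀ x y → ∃[ n ] Path n x y

  -- The functor from the one-object groupoid A₁(X,x₀) to Π₁X sending the
  -- object to x₀ and acting on morphisms by φ is an equivalence of
  -- categories: it is a functor, fully faithful and essentially surjective.
  record IsEquivalenceOfCategories (x₀ : V) (φ : Loop∞ x₀ → PathN x₀ x₀) : Set where
    field
      F-hom  : ∀ γ σ τ → IsConcat∞ γ σ τ →
               ∀ c → IsConcatFin (φ γ) (φ σ) c → SameΠ₁ (φ τ) c
      F-id   : SameΠ₁ (φ (constLoop x₀)) (idPath x₀)
      F-resp : ∀ γ σ → SameA₁ γ σ → SameΠ₁ (φ γ) (φ σ)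
      faithful : ∀ γ σ → SameΠ₁ (φ γ) (φ σ) → SameA₁ γ σ
      full     : ∀ c → ∃[ γ ] SameΠ₁ (φ γ) c
      essSurj  : ∀ x → Σ[ f ∈ PathN x₀ x ] Σ[ g ∈ PathN x x₀ ]
                   (∀ c → IsConcatFin f g c → SameΠ₁ c (idPath x₀)) ×
                   (∀ c → IsConcatFin g f c → SameΠ₁ c (idPath x))

-- The map φ = toPath restricts a loop to a window [N₋, N₊] outside of which it is constant.
-- Two windows of the same loop differ by constant padding, i.e. by a reparametrisation, so φ
-- respects adjacency of loops. Conversely a finite path extends to a loop by constants, and every
-- loop is joined to the extension of its window through its translates, consecutive translates
-- being adjacent because a loop is a graph map. A reparametrisation s is undone in Ω∞ by the
-- homotopy that follows s up to time t and then moves at unit speed. Concatenating loops agrees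
-- with concatenating their windows up to where the two cuts lie in the constant middle part, and
-- moving a cut by one step is again an adjacency. If X is connected, a path followed by its
-- reverse contracts by walking out only up to time t and back.

module Submission where

open import Defs
open import Data.Bool using (true; false; T)
open import Data.Empty using (⊥-elim)
open import Data.Fin using (Fin; zero; suc; inject₁; fromℕ; toℕ; fromℕ<)
open import Data.Fin.Properties using (toℕ-inject₁; toℕ-fromℕ; toℕ-fromℕ<; toℕ≤pred[n])
open import Data.Integer as ℤ using (ℤ; +_; -[1+_]; 0ℤ; 1ℤ)
import Data.Integer.Properties as ℤP
open import Data.Integer.Tactic.RingSolver using (solve-∀)
open import Data.Nat as ℕ using (ℕ; zero; suc; _∸_; _⊓_; _≤ᵇ_; z≤n; s≤s)
import Data.Nat.Properties as ℕP
open import Data.Product using (Σ-syntax; ∃-syntax; _×_; _,_; proj₁; proj₂)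
open import Data.Sum using (_⊎_; inj₁; inj₂)
open import Function using (_∘_)
open import Relation.Binary using (Rel; tri<; tri≈; tri>)
open import Relation.Binary.Construct.Closure.ReflexiveTransitive as Star
  using (Star; ε; _◅_; _◅◅_)
open import Relation.Binary.PropositionalEquality
  using (_≡_; refl; sym; trans; cong; cong₂; subst; subst₂; module ≡-Reasoning)
open import Relation.Nullary using (¬_; yes; no)

Near : ℕ → ℕ → Set
Near a b = a ℕ.≤ suc b × b ℕ.≤ suc a

near-refl : ∀ a → Near a a
near-refl a = ℕP.n≤1+n a , ℕP.n≤1+n a

near-sym : ∀ {a b} → Near a b → Near b a
near-sym (a≤1+b , b≤1+a) = b≤1+a , a≤1+b

near-suc : ∀ a → Near a (suc a)
near-suc a = ℕP.m≤n⇒m≤1+n (ℕP.n≤1+n a) , ℕP.≤-refl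

near-⊓ : ∀ {a b c d} → Near a b → Near c d → Near (a ⊓ c) (b ⊓ d)
near-⊓ (a≤1+b , b≤1+a) (c≤1+d , d≤1+c) = ℕP.⊓-mono-≤ a≤1+b c≤1+d , ℕP.⊓-mono-≤ b≤1+a d≤1+c

near-+ˡ : ∀ {a b} c → Near a b → Near (c ℕ.+ a) (c ℕ.+ b)
near-+ˡ {a} {b} c (a≤1+b , b≤1+a) =
  subst (c ℕ.+ a ℕ.≤_) (ℕP.+-suc c b) (ℕP.+-monoʳ-≤ c a≤1+b) ,
  subst (c ℕ.+ b ℕ.≤_) (ℕP.+-suc c a) (ℕP.+-monoʳ-≤ c b≤1+a)

near-∸ʳ : ∀ k i → Near (k ∸ i) (k ∸ suc i)
near-∸ʳ k i = ∸-suc k i , ℕP.m≤n⇒m≤1+n (ℕP.∸-monoʳ-≤ k (ℕP.n≤1+n i))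
  where
  ∸-suc : ∀ k i → k ∸ i ℕ.≤ suc (k ∸ suc i)
  ∸-suc zero    i       = subst (ℕ._≤ 1) (sym (ℕP.0∸n≡0 i)) z≤n
  ∸-suc (suc k) zero    = ℕP.≤-refl
  ∸-suc (suc k) (suc i) = ∸-suc k i

near-∸ˡ : ∀ i d → Near (i ∸ d) (suc i ∸ d)
near-∸ˡ i       zero    = near-suc i
near-∸ˡ zero    (suc d) = subst (Near 0) (sym (ℕP.0∸n≡0 d)) (near-refl 0)
near-∸ˡ (suc i) (suc d) = near-∸ˡ i d

tent : ℕ → ℕ → ℕ
tent n i = i ⊓ (n ℕ.+ n ∸ i)

tent-≤ : ∀ {n i} → i ℕ.≤ n → tent n i ⊓ n ≡ i
tent-≤ {n} {i} i≤n = trans (cong (_⊓ n) (ℕP.m≤n⇒m⊓n≡m i≤n+n∸i)) (ℕP.m≤n⇒m⊓n≡m i≤n)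
  where
  i≤n+n∸i : i ℕ.≤ n ℕ.+ n ∸ i
  i≤n+n∸i = subst (ℕ._≤ n ℕ.+ n ∸ i) (ℕP.m+n∸n≡m i i) (ℕP.∸-monoˡ-≤ i (ℕP.+-mono-≤ i≤n i≤n))

tent-≥ : ∀ {n i} → n ℕ.≤ i → tent n i ⊓ n ≡ n ∸ (i ∸ n)
tent-≥ {n} {i} n≤i = begin
  (i ⊓ (n ℕ.+ n ∸ i)) ⊓ n ≡⟨ cong (_⊓ n) (ℕP.m≥n⇒m⊓n≡n (ℕP.≤-trans n+n∸i≤n n≤i)) ⟩
  (n ℕ.+ n ∸ i) ⊓ n       ≡⟨ ℕP.m≤n⇒m⊓n≡m n+n∸i≤n ⟩
  n ℕ.+ n ∸ i             ≡⟨ n+n∸i≡n∸d ⟩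
  n ∸ (i ∸ n)             ∎
  where
  open ≡-Reasoning
  n+n∸i≡n∸d : n ℕ.+ n ∸ i ≡ n ∸ (i ∸ n)
  n+n∸i≡n∸d = trans (cong (n ℕ.+ n ∸_) (sym (ℕP.m+[n∸m]≡n n≤i))) (ℕP.[m+n]∸[m+o]≡n∸o n n (i ∸ n))
  n+n∸i≤n : n ℕ.+ n ∸ i ℕ.≤ n
  n+n∸i≤n = subst (ℕ._≤ n) (sym n+n∸i≡n∸d) (ℕP.m∸n≤m n (i ∸ n))

≤⇒≤ᵇ≡true : ∀ {i n} → i ℕ.≤ n → (i ≤ᵇ n) ≡ true
≤⇒≤ᵇ≡true {i} {n} i≤n with i ≤ᵇ n | ℕP.≤⇒≤ᵇ i≤n
... | true | _ = refl

≰⇒≤ᵇ≡false : ∀ {i n} → ¬ (i ℕ.≤ n) → (i ≤ᵇ n) ≡ false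
≰⇒≤ᵇ≡false {i} {n} i≰n with i ≤ᵇ n in eq
... | false = refl
... | true  = ⊥-elim (i≰n (ℕP.≤ᵇ⇒≤ i n (subst T (sym eq) _)))

j≡i+[j-i] : ∀ i j → j ≡ i ℤ.+ (j ℤ.- i)
j≡i+[j-i] = solve-∀

i≤j⇒j≡i+∣j-i∣ : ∀ {i j} → i ℤ.≤ j → j ≡ i ℤ.+ + ℤ.∣ j ℤ.- i ∣
i≤j⇒j≡i+∣j-i∣ {i} {j} i≤j =
  trans (j≡i+[j-i] i j) (cong (λ k → i ℤ.+ k) (sym (ℤP.0≤i⇒+∣i∣≡i (ℤP.i≤j⇒0≤j-i i≤j))))

j≤i+∣j-i∣ : ∀ i j → j ℤ.≤ i ℤ.+ + ℤ.∣ j ℤ.- i ∣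
j≤i+∣j-i∣ i j = subst (ℤ._≤ i ℤ.+ + ℤ.∣ j ℤ.- i ∣) (sym (j≡i+[j-i] i j)) (ℤP.+-monoʳ-≤ i (k≤∣k∣ (j ℤ.- i)))
  where
  k≤∣k∣ : ∀ k → k ℤ.≤ + ℤ.∣ k ∣
  k≤∣k∣ (+ _)    = ℤP.≤-refl
  k≤∣k∣ -[1+ _ ] = ℤ.-≤+

i+[1+n]≡[i+n]+1 : ∀ i n → i ℤ.+ + suc n ≡ (i ℤ.+ + n) ℤ.+ 1ℤ
i+[1+n]≡[i+n]+1 i n = trans (cong (λ k → i ℤ.+ k) (ℤP.pos-+ 1 n)) (assoc-comm i (+ n))
  where
  assoc-comm : ∀ i j → i ℤ.+ (1ℤ ℤ.+ j) ≡ (i ℤ.+ j) ℤ.+ 1ℤ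
  assoc-comm = solve-∀

i+[m+n]≡[i+m]+n : ∀ i m n → i ℤ.+ + (m ℕ.+ n) ≡ (i ℤ.+ + m) ℤ.+ + n
i+[m+n]≡[i+m]+n i m n = trans (cong (λ k → i ℤ.+ k) (ℤP.pos-+ m n)) (sym (ℤP.+-assoc i (+ m) (+ n)))

i+m≤i+n⇒m≤n : ∀ i {m n} → i ℤ.+ + m ℤ.≤ i ℤ.+ + n → m ℕ.≤ n
i+m≤i+n⇒m≤n i {m} {n} le =
  ℤ.drop‿+≤+ (subst₂ ℤ._≤_ (cancel i (+ m)) (cancel i (+ n)) (ℤP.+-monoʳ-≤ (ℤ.- i) le))
  where
  cancel : ∀ i j → ℤ.- i ℤ.+ (i ℤ.+ j) ≡ j
  cancel = solve-∀

≰⇒≥ : ∀ {i j} → ¬ i ℤ.≤ j → j ℤ.≤ i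
≰⇒≥ i≰j = ℤP.<⇒≤ (ℤP.≰⇒> i≰j)

i+1≰j⇒j≤i : ∀ {i j} → ¬ i ℤ.+ 1ℤ ℤ.≤ j → j ℤ.≤ i
i+1≰j⇒j≤i {i} i+1≰j = subst (_ ℤ.≤_) (pred[i+1]≡i i) (ℤP.i<j⇒i≤pred[j] (ℤP.≰⇒> i+1≰j))
  where
  pred[i+1]≡i : ∀ i → ℤ.-1ℤ ℤ.+ (i ℤ.+ 1ℤ) ≡ i
  pred[i+1]≡i = solve-∀

i≤j⇒i-j+k≤k : ∀ {i j} k → i ℤ.≤ j → i ℤ.- j ℤ.+ k ℤ.≤ k
i≤j⇒i-j+k≤k {i} {j} k i≤j =
  subst (i ℤ.- j ℤ.+ k ℤ.≤_) (j-j+k≡k j k) (ℤP.+-monoˡ-≤ k (ℤP.+-monoˡ-≤ (ℤ.- j) i≤j))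
  where
  j-j+k≡k : ∀ j k → j ℤ.- j ℤ.+ k ≡ k
  j-j+k≡k = solve-∀

i+-mono-≤ : ∀ i {m n} → m ℕ.≤ n → i ℤ.+ + m ℤ.≤ i ℤ.+ + n
i+-mono-≤ i m≤n = ℤP.+-monoʳ-≤ i (ℤ.+≤+ m≤n)

module _ {a ℓ} {A : Set a} {R : Rel A ℓ} (f : ℕ → A) where

  chain↑ : (∀ t → R (f t) (f (suc t))) → ∀ t → Star R (f 0) (f t)
  chain↑ step zero    = ε
  chain↑ step (suc t) = chain↑ step t ◅◅ (step t ◅ ε)

  chain↓ : (∀ t → R (f (suc t)) (f t)) → ∀ t → Star R (f t) (f 0)
  chain↓ step zero    = ε
  chain↓ step (suc t) = step t ◅ chain↓ step t

-- The surjective order-preserving maps I_m → I_n of the paper, extended to ℕ.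

record IsDegeneracy (s : ℕ → ℕ) : Set where
  field
    fix-0 : s 0 ≡ 0
    mono  : ∀ {i j} → i ℕ.≤ j → s i ℕ.≤ s j
    step  : ∀ i → s (suc i) ℕ.≤ suc (s i)

  step-near : ∀ i → Near (s i) (s (suc i))
  step-near i = ℕP.m≤n⇒m≤1+n (mono (ℕP.n≤1+n i)) , step i

  step-cases : ∀ i → s i ≡ s (suc i) ⊎ suc (s i) ≡ s (suc i)
  step-cases i with ℕP.m≤n⇒m<n∨m≡n (mono (ℕP.n≤1+n i))
  ... | inj₁ s<s′ = inj₂ (ℕP.≤-antisym s<s′ (step i))
  ... | inj₂ s≡s′ = inj₁ s≡s′

  lipschitz : ∀ t k → s (t ℕ.+ k) ℕ.≤ s t ℕ.+ k
  lipschitz t zero    rewrite ℕP.+-identityʳ t | ℕP.+-identityʳ (s t) = ℕP.≤-refl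
  lipschitz t (suc k) rewrite ℕP.+-suc t k | ℕP.+-suc (s t) k =
    ℕP.≤-trans (step (t ℕ.+ k)) (s≤s (lipschitz t k))

  hits : ∀ t j → j ℕ.≤ s t → ∃[ i ] (i ℕ.≤ t × s i ≡ j)
  hits zero    j j≤s0 = 0 , z≤n , trans fix-0 (sym (ℕP.n≤0⇒n≡0 (subst (j ℕ.≤_) fix-0 j≤s0)))
  hits (suc t) j j≤s with j ℕ.≤? s t
  ... | yes j≤st = let (i , i≤t , si≡j) = hits t j j≤st in i , ℕP.m≤n⇒m≤1+n i≤t , si≡j
  ... | no  j≰st = suc t , ℕP.≤-refl , ℕP.≤-antisym (ℕP.≤-trans (step t) (ℕP.≰⇒> j≰st)) j≤s

-- Follow s until time t, then move at unit speed: lazy t is s for large t and the identity for t = 0.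
module Lazy {s : ℕ → ℕ} (deg : IsDegeneracy s) where
  open IsDegeneracy deg

  lazy : ℕ → ℕ → ℕ
  lazy t i = s (i ⊓ t) ℕ.+ (i ∸ t)

  lazy-identity : ∀ i → lazy 0 i ≡ i
  lazy-identity i rewrite ℕP.⊓-zeroʳ i | fix-0 = refl

  lazy-≤ : ∀ {t i} → i ℕ.≤ t → lazy t i ≡ s i
  lazy-≤ {t} {i} i≤t rewrite ℕP.m≤n⇒m⊓n≡m i≤t | ℕP.m≤n⇒m∸n≡0 i≤t = ℕP.+-identityʳ (s i)

  lazy-≥ : ∀ {t i} → t ℕ.≤ i → lazy t i ≡ s t ℕ.+ (i ∸ t)
  lazy-≥ {t} {i} t≤i = cong (λ j → s j ℕ.+ (i ∸ t)) (ℕP.m≥n⇒m⊓n≡n t≤i)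

  lazy-origin : ∀ t → lazy t 0 ≡ 0
  lazy-origin t = trans (lazy-≤ {t} z≤n) fix-0

  s≤lazy : ∀ t i → s i ℕ.≤ lazy t i
  s≤lazy t i with i ℕ.≤? t
  ... | yes i≤t = ℕP.≤-reflexive (sym (lazy-≤ i≤t))
  ... | no  i≰t = subst₂ ℕ._≤_ (cong s (ℕP.m+[n∸m]≡n t≤i)) (sym (lazy-≥ t≤i)) (lipschitz t (i ∸ t))
    where t≤i = ℕP.<⇒≤ (ℕP.≰⇒> i≰t)

  lazy-near-i : ∀ t i → Near (lazy t i) (lazy t (suc i))
  lazy-near-i t i with suc i ℕ.≤? t
  ... | yes 1+i≤t = subst₂ Near (sym (lazy-≤ (ℕP.<⇒≤ 1+i≤t))) (sym (lazy-≤ 1+i≤t)) (step-near i)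
  ... | no  1+i≰t = subst₂ Near (sym (lazy-≥ t≤i)) (sym (lazy-≥ (ℕP.m≤n⇒m≤1+n t≤i)))
                            (near-+ˡ (s t) (near-∸ˡ i t))
    where t≤i = ℕ.s≤s⁻¹ (ℕP.≰⇒> 1+i≰t)

  lazy-near-t : ∀ t i → Near (lazy t i) (lazy (suc t) i)
  lazy-near-t t i with i ℕ.≤? t
  ... | yes i≤t = subst₂ Near (sym (lazy-≤ i≤t)) (sym (lazy-≤ (ℕP.m≤n⇒m≤1+n i≤t))) (near-refl (s i))
  ... | no  i≰t = subst₂ Near (sym (lazy-≥ (ℕP.<⇒≤ t<i))) (sym (lazy-≥ t<i)) near
    where
    t<i = ℕP.≰⇒> i≰t
    near : Near (s t ℕ.+ (i ∸ t)) (s (suc t) ℕ.+ (i ∸ suc t))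
    near rewrite ℕP.+-∸-assoc 1 t<i | ℕP.+-suc (s t) (i ∸ suc t) =
      s≤s (ℕP.+-monoˡ-≤ (i ∸ suc t) (mono (ℕP.n≤1+n t))) ,
      ℕP.m≤n⇒m≤1+n (ℕP.+-monoˡ-≤ (i ∸ suc t) (step t))

-- Finite paths

module Paths (X : Graph) where
  open Graph X using (V; ~-sym)

  EqAdj-refl : ∀ {x} → EqAdj X x x
  EqAdj-refl = inj₁ refl

  EqAdj-sym : ∀ {x y} → EqAdj X x y → EqAdj X y x
  EqAdj-sym (inj₁ x≡y) = inj₁ (sym x≡y)
  EqAdj-sym (inj₂ x~y) = inj₂ (~-sym x~y)

  Walk : (ℕ → V) → Set
  Walk f = ∀ i → EqAdj X (f i) (f (suc i))

  walk-near : ∀ {f} → Walk f → ∀ {a b} → Near a b → EqAdj X (f a) (f b)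
  walk-near {f} w {a} {b} (a≤1+b , b≤1+a) with ℕP.<-cmp a b
  ... | tri≈ _ refl _ = EqAdj-refl
  ... | tri< a<b _ _  = subst (λ c → EqAdj X (f a) (f c)) (ℕP.≤-antisym a<b b≤1+a) (w a)
  ... | tri> _ _ b<a  = EqAdj-sym (subst (λ c → EqAdj X (f b) (f c)) (ℕP.≤-antisym b<a a≤1+b) (w b))

  walk-∘ : ∀ {f} → Walk f → ∀ {s} → (∀ i → Near (s i) (s (suc i))) → Walk (f ∘ s)
  walk-∘ w near i = walk-near w (near i)

  toℕ-clamp : ∀ n i → toℕ (clamp X n i) ≡ i ⊓ n
  toℕ-clamp zero    zero    = refl
  toℕ-clamp zero    (suc i) = refl
  toℕ-clamp (suc n) zero    = refl
  toℕ-clamp (suc n) (suc i) = cong suc (toℕ-clamp n i)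

  clamp-toℕ : ∀ n (j : Fin (suc n)) → clamp X n (toℕ j) ≡ j
  clamp-toℕ zero    zero    = refl
  clamp-toℕ (suc n) zero    = refl
  clamp-toℕ (suc n) (suc j) = cong suc (clamp-toℕ n j)

  toℕ-clamp-≤ : ∀ n i → i ℕ.≤ n → toℕ (clamp X n i) ≡ i
  toℕ-clamp-≤ n i i≤n = trans (toℕ-clamp n i) (ℕP.m≤n⇒m⊓n≡m i≤n)

  clamp-toℕ-inject₁ : ∀ {n} (j : Fin n) → clamp X n (toℕ j) ≡ inject₁ j
  clamp-toℕ-inject₁ {n} j = trans (cong (clamp X n) (sym (toℕ-inject₁ j))) (clamp-toℕ n (inject₁ j))

  clamp-zero : ∀ n → clamp X n 0 ≡ zero
  clamp-zero zero    = refl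
  clamp-zero (suc n) = refl

  clamp-≥ : ∀ n i → n ℕ.≤ i → clamp X n i ≡ fromℕ n
  clamp-≥ zero    i       _         = refl
  clamp-≥ (suc n) (suc i) (s≤s n≤i) = cong suc (clamp-≥ n i n≤i)

  clamp-walk : ∀ n (p : Fin (suc n) → V) → (∀ i → EqAdj X (p (inject₁ i)) (p (suc i))) →
               Walk (p ∘ clamp X n)
  clamp-walk zero    p map i       = EqAdj-refl
  clamp-walk (suc n) p map zero    =
    subst (λ j → EqAdj X (p zero) (p (suc j))) (sym (clamp-zero n)) (map zero)
  clamp-walk (suc n) p map (suc i) = clamp-walk n (p ∘ suc) (map ∘ suc) i

  module _ {x x' : V} where

    len : PathN X x x' → ℕ
    len = proj₁

    at-walk : (p : PathN X x x') → Walk (at X p)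
    at-walk (n , P) = clamp-walk n (Path.p P) (Path.map P)

    at-zero : (p : PathN X x x') → at X p 0 ≡ x
    at-zero (n , P) = trans (cong (Path.p P) (clamp-zero n)) (Path.start P)

    at-≥len : (p : PathN X x x') → ∀ i → len p ℕ.≤ i → at X p i ≡ x'
    at-≥len (n , P) i n≤i = trans (cong (Path.p P) (clamp-≥ n i n≤i)) (Path.finish P)

    at-toℕ : ∀ {n} (P : Path X n x x') (j : Fin (suc n)) → at X (n , P) (toℕ j) ≡ Path.p P j
    at-toℕ {n} P j = cong (Path.p P) (clamp-toℕ n j)

    fromWalk : ∀ n f → Walk f → f 0 ≡ x → f n ≡ x' → PathN X x x'
    fromWalk n f w f0 fn = n , record
      { p      = f ∘ toℕ
      ; map    = λ i → subst (λ j → EqAdj X (f j) (f (suc (toℕ i)))) (sym (toℕ-inject₁ i)) (w (toℕ i))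
      ; start  = f0
      ; finish = trans (cong f (toℕ-fromℕ n)) fn }

    degeneracy-Reparam : ∀ {s} → IsDegeneracy s → (p q : PathN X x x') → s (len p) ≡ len q →
                         (∀ i → i ℕ.≤ len p → at X p i ≡ at X q (s i)) → Reparam X p q
    degeneracy-Reparam {s} deg (m , P) (n , Q) sm≡n agree = s′ , (mono′ , step′ , surj′) , agree′
      where
      open IsDegeneracy deg
      s′ : Fin (suc m) → Fin (suc n)
      s′ = clamp X n ∘ s ∘ toℕ
      toℕ-s′ : ∀ i → toℕ (s′ i) ≡ s (toℕ i)
      toℕ-s′ i = trans (toℕ-clamp n (s (toℕ i)))
                       (ℕP.m≤n⇒m⊓n≡m (subst (s (toℕ i) ℕ.≤_) sm≡n (mono (toℕ≤pred[n] i))))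
      mono′ : ∀ i j → toℕ i ℕ.≤ toℕ j → toℕ (s′ i) ℕ.≤ toℕ (s′ j)
      mono′ i j i≤j rewrite toℕ-s′ i | toℕ-s′ j = mono i≤j
      step′ : ∀ (i : Fin m) → toℕ (s′ (inject₁ i)) ≡ toℕ (s′ (suc i))
                            ⊎ suc (toℕ (s′ (inject₁ i))) ≡ toℕ (s′ (suc i))
                            ⊎ toℕ (s′ (inject₁ i)) ≡ suc (toℕ (s′ (suc i)))
      step′ i rewrite toℕ-s′ (inject₁ i) | toℕ-s′ (suc i) | toℕ-inject₁ i with step-cases (toℕ i)
      ... | inj₁ same = inj₁ same
      ... | inj₂ up   = inj₂ (inj₁ up)
      surj′ : ∀ j → ∃[ i ] s′ i ≡ j
      surj′ j with hits m (toℕ j) (subst (toℕ j ℕ.≤_) (sym sm≡n) (toℕ≤pred[n] j))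
      ... | i , i≤m , si≡j = fromℕ< (s≤s i≤m) ,
            trans (cong (clamp X n ∘ s) (toℕ-fromℕ< (s≤s i≤m)))
                  (trans (cong (clamp X n) si≡j) (clamp-toℕ n j))
      agree′ : ∀ i → Path.p P i ≡ Path.p Q (s′ i)
      agree′ i = trans (sym (at-toℕ P i)) (agree (toℕ i) (toℕ≤pred[n] i))

    Reparam⇒SameΠ₁ : {p q : PathN X x x'} → Reparam X p q → SameΠ₁ X p q
    Reparam⇒SameΠ₁ r = inj₂ (inj₁ r) ◅ ε

    Reparam⇒SameΠ₁˘ : {p q : PathN X x x'} → Reparam X q p → SameΠ₁ X p q
    Reparam⇒SameΠ₁˘ r = inj₂ (inj₂ r) ◅ ε

    id-degeneracy : IsDegeneracy (λ i → i)
    id-degeneracy = record { fix-0 = refl ; mono = λ i≤j → i≤j ; step = λ _ → ℕP.≤-refl }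

    pointwise⇒SameΠ₁ : (p q : PathN X x x') → len p ≡ len q →
                       (∀ i → i ℕ.≤ len p → at X p i ≡ at X q i) → SameΠ₁ X p q
    pointwise⇒SameΠ₁ p q len≡ agree = Reparam⇒SameΠ₁ (degeneracy-Reparam id-degeneracy p q len≡ agree)

  constant⇒SameΠ₁-idPath : ∀ {x} (p : PathN X x x) → (∀ i → i ℕ.≤ len p → at X p i ≡ x) →
                           SameΠ₁ X p (idPath X x)
  constant⇒SameΠ₁-idPath p const = Reparam⇒SameΠ₁ (degeneracy-Reparam collapse p (idPath X _) refl const)
    where
    collapse : IsDegeneracy (λ _ → 0)
    collapse = record { fix-0 = refl ; mono = λ _ → z≤n ; step = λ _ → z≤n }

  onℕ : ∀ {m n} → (Fin (suc m) → Fin (suc n)) → ℕ → ℕ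
  onℕ {m} s i = toℕ (s (clamp X m i))

  module _ {m n} {s : Fin (suc m) → Fin (suc n)} (isr : IsReparam X m n s) where
    private
      mono = proj₁ isr
      steps = proj₁ (proj₂ isr)
      surj = proj₂ (proj₂ isr)

    IsReparam⇒IsDegeneracy : IsDegeneracy (onℕ s)
    IsReparam⇒IsDegeneracy = record { fix-0 = fix-0 ; mono = mono′ ; step = step }
      where
      fix-0 : onℕ s 0 ≡ 0
      fix-0 rewrite clamp-zero m with surj zero
      ... | i , si≡0 = ℕP.n≤0⇒n≡0 (subst (λ j → toℕ (s zero) ℕ.≤ toℕ j) si≡0 (mono zero i z≤n))
      mono′ : ∀ {i j} → i ℕ.≤ j → onℕ s i ℕ.≤ onℕ s j
      mono′ {i} {j} i≤j = mono (clamp X m i) (clamp X m j)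
        (subst₂ ℕ._≤_ (sym (toℕ-clamp m i)) (sym (toℕ-clamp m j)) (ℕP.⊓-monoˡ-≤ m i≤j))
      step-fin : ∀ (j : Fin m) → onℕ s (suc (toℕ j)) ℕ.≤ suc (onℕ s (toℕ j))
      step-fin j rewrite clamp-toℕ m (suc j) | clamp-toℕ-inject₁ j with steps j
      ... | inj₁ same        = subst (ℕ._≤ suc (toℕ (s (inject₁ j)))) same (ℕP.n≤1+n _)
      ... | inj₂ (inj₁ up)   = ℕP.≤-reflexive (sym up)
      ... | inj₂ (inj₂ down) =
            ⊥-elim (ℕP.n≮n _ (subst (ℕ._≤ toℕ (s (suc j))) down (mono (inject₁ j) (suc j) inject₁≤suc)))
        where
        inject₁≤suc : toℕ (inject₁ j) ℕ.≤ suc (toℕ j)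
        inject₁≤suc = subst (ℕ._≤ suc (toℕ j)) (sym (toℕ-inject₁ j)) (ℕP.n≤1+n _)
      step : ∀ i → onℕ s (suc i) ℕ.≤ suc (onℕ s i)
      step i with i ℕ.<? m
      ... | no  i≮m rewrite clamp-≥ m i (ℕP.≮⇒≥ i≮m) | clamp-≥ m (suc i) (ℕP.m≤n⇒m≤1+n (ℕP.≮⇒≥ i≮m)) =
            ℕP.n≤1+n _
      ... | yes i<m = subst (λ k → onℕ s (suc k) ℕ.≤ suc (onℕ s k)) (toℕ-fromℕ< i<m) (step-fin (fromℕ< i<m))

    IsReparam⇒onℕ-top : ∀ i → m ℕ.≤ i → onℕ s i ≡ n
    IsReparam⇒onℕ-top i m≤i rewrite clamp-≥ m i m≤i with surj (fromℕ n)
    ... | k , sk≡n = ℕP.≤-antisym (toℕ≤pred[n] (s (fromℕ m)))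
          (subst (ℕ._≤ toℕ (s (fromℕ m))) (trans (cong toℕ sk≡n) (toℕ-fromℕ n))
                 (mono k (fromℕ m) (subst (toℕ k ℕ.≤_) (sym (toℕ-fromℕ m)) (toℕ≤pred[n] k))))

  module _ {x y : V} where

    IsReverseOf : PathN X y x → PathN X x y → Set
    IsReverseOf q p = len q ≡ len p × (∀ i → i ℕ.≤ len p → at X q i ≡ at X p (len p ∸ i))

    reverse : PathN X x y → PathN X y x
    reverse p = fromWalk (len p) (at X p ∘ (len p ∸_)) (walk-∘ (at-walk p) (near-∸ʳ (len p)))
                  (at-≥len p (len p ∸ 0) ℕP.≤-refl)
                  (trans (cong (at X p) (ℕP.n∸n≡0 (len p))) (at-zero p))

    reverse-IsReverseOf : (p : PathN X x y) → IsReverseOf (reverse p) p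
    reverse-IsReverseOf p = refl , λ i i≤n →
      cong (at X p ∘ (len p ∸_)) (toℕ-clamp-≤ (len p) i i≤n)

    -- H t walks along p up to time t and back: H n is p followed by q and H 0 is constant.
    concat-reverse-SameΠ₁ : (p : PathN X x y) (q : PathN X y x) → IsReverseOf q p →
                            ∀ c → IsConcatFin X p q c → SameΠ₁ X c (idPath X x)
    concat-reverse-SameΠ₁ p q (len≡ , backwards) c (len-c , at-c) =
      pointwise⇒SameΠ₁ c (H n) len-c′ agree ◅◅ chain↓ H shrink n ◅◅ constant⇒SameΠ₁-idPath (H 0) at-H0
      where
      n = len p
      len-c′ : len c ≡ n ℕ.+ n
      len-c′ = trans len-c (cong (n ℕ.+_) len≡)
      h : ℕ → ℕ → V
      h t i = at X p (tent n i ⊓ t)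
      h-walk : ∀ t → Walk (h t)
      h-walk t = walk-∘ (at-walk p) λ i →
        near-⊓ (near-⊓ (near-suc i) (near-∸ʳ (n ℕ.+ n) i)) (near-refl t)
      h-end : ∀ t → h t (n ℕ.+ n) ≡ x
      h-end t rewrite ℕP.n∸n≡0 (n ℕ.+ n) | ℕP.⊓-zeroʳ (n ℕ.+ n) = at-zero p
      H : ℕ → PathN X x x
      H t = fromWalk (n ℕ.+ n) (h t) (h-walk t) (at-zero p) (h-end t)
      shrink : ∀ t → PNStep X (H (suc t)) (H t)
      shrink t = inj₁ (refl , λ _ → walk-near (at-walk p) (near-⊓ (near-refl _) (near-sym (near-suc t))))
      at-H0 : ∀ i → i ℕ.≤ n ℕ.+ n → at X (H 0) i ≡ x
      at-H0 i i≤2n = trans (cong (h 0) (toℕ-clamp-≤ (n ℕ.+ n) i i≤2n))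
                           (trans (cong (at X p) (ℕP.⊓-zeroʳ (tent n i))) (at-zero p))
      agree : ∀ i → i ℕ.≤ len c → at X c i ≡ at X (H n) i
      agree i i≤k with subst (i ℕ.≤_) len-c′ i≤k
      ... | i≤2n rewrite at-c i (subst (λ m → i ℕ.≤ n ℕ.+ m) (sym len≡) i≤2n)
                       | toℕ-clamp-≤ (n ℕ.+ n) i i≤2n
                       with i ℕ.≤? n
      ... | yes i≤n rewrite ≤⇒≤ᵇ≡true i≤n = cong (at X p) (sym (tent-≤ i≤n))
      ... | no  i≰n rewrite ≰⇒≤ᵇ≡false i≰n =
            trans (backwards (i ∸ n) i∸n≤n) (cong (at X p) (sym (tent-≥ n≤i)))
        where
        n≤i = ℕP.<⇒≤ (ℕP.≰⇒> i≰n)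
        i∸n≤n = ℕP.+-cancelˡ-≤ n (i ∸ n) n (subst (ℕ._≤ n ℕ.+ n) (sym (ℕP.m+[n∸m]≡n n≤i)) i≤2n)

  IsReverseOf-sym : ∀ {x y} {q : PathN X y x} {p : PathN X x y} → IsReverseOf q p → IsReverseOf p q
  IsReverseOf-sym {q = q} {p} (len≡ , backwards) = sym len≡ , λ i i≤m →
    let i≤n = subst (i ℕ.≤_) len≡ i≤m in
    sym (begin
      at X q (len q ∸ i)             ≡⟨ cong (λ m → at X q (m ∸ i)) len≡ ⟩
      at X q (len p ∸ i)             ≡⟨ backwards (len p ∸ i) (ℕP.m∸n≤m (len p) i) ⟩
      at X p (len p ∸ (len p ∸ i))   ≡⟨ cong (at X p) (ℕP.m∸[m∸n]≡n i≤n) ⟩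
      at X p i                       ∎)
    where open ≡-Reasoning

  reverse-inverse : ∀ {x y} (p : PathN X x y) →
    (∀ c → IsConcatFin X p (reverse p) c → SameΠ₁ X c (idPath X x)) ×
    (∀ c → IsConcatFin X (reverse p) p c → SameΠ₁ X c (idPath X y))
  reverse-inverse p =
    concat-reverse-SameΠ₁ p (reverse p) (reverse-IsReverseOf p) ,
    concat-reverse-SameΠ₁ (reverse p) p (IsReverseOf-sym {q = reverse p} {p} (reverse-IsReverseOf p))

-- Windows of loops

module Loops (X : Graph) (x₀ : Graph.V X) where
  open Graph X using (V)
  open Paths X

  Loop : Set
  Loop = Loop∞ X x₀

  open Loop∞ using (N₋; N₊) renaming (γ to _⟨_⟩)

  record IsWindow (γ : Loop) (a : ℤ) (L : ℕ) : Set where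
    constructor _,_
    field
      below : ∀ z → z ℤ.≤ a → γ ⟨ z ⟩ ≡ x₀
      above : ∀ z → a ℤ.+ + L ℤ.≤ z → γ ⟨ z ⟩ ≡ x₀

  IsWindow-widen : ∀ {γ a L b d M} → IsWindow γ a L → a ≡ b ℤ.+ + d → d ℕ.+ L ℕ.≤ M → IsWindow γ b M
  IsWindow-widen {γ} {a} {L} {b} {d} {M} (below , above) a≡b+d d+L≤M =
    (λ z z≤b → below z (ℤP.≤-trans z≤b b≤a)) , (λ z b+M≤z → above z (ℤP.≤-trans a+L≤b+M b+M≤z))
    where
    b≤a : b ℤ.≤ a
    b≤a = subst (b ℤ.≤_) (sym a≡b+d) (ℤP.i≤i+j b (+ d))
    a+L≤b+M : a ℤ.+ + L ℤ.≤ b ℤ.+ + M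
    a+L≤b+M = subst (ℤ._≤ b ℤ.+ + M) (trans (i+[m+n]≡[i+m]+n b d L) (cong (ℤ._+ + L) (sym a≡b+d)))
                    (i+-mono-≤ b d+L≤M)

  module Hull (a : ℤ) (L : ℕ) (a′ : ℤ) (L′ : ℕ) where
    start : ℤ
    start = a ℤ.⊓ a′

    d d′ size : ℕ
    d     = ℤ.∣ a ℤ.- start ∣
    d′    = ℤ.∣ a′ ℤ.- start ∣
    size  = (d ℕ.+ L) ℕ.+ (d′ ℕ.+ L′)

    a≡start+d : a ≡ start ℤ.+ + d
    a≡start+d = i≤j⇒j≡i+∣j-i∣ (ℤP.i⊓j≤i a a′)

    a′≡start+d′ : a′ ≡ start ℤ.+ + d′
    a′≡start+d′ = i≤j⇒j≡i+∣j-i∣ (ℤP.i⊓j≤j a a′)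

    d+L≤size : d ℕ.+ L ℕ.≤ size
    d+L≤size = ℕP.m≤m+n (d ℕ.+ L) (d′ ℕ.+ L′)

    d′+L′≤size : d′ ℕ.+ L′ ℕ.≤ size
    d′+L′≤size = ℕP.m≤n+m (d′ ℕ.+ L′) (d ℕ.+ L)

  from : Loop → ℤ → ℕ → V
  from γ a i = γ ⟨ a ℤ.+ + i ⟩

  from-walk : ∀ γ a → Walk (from γ a)
  from-walk γ a i = subst (λ z → EqAdj X (from γ a i) (γ ⟨ z ⟩)) (sym (i+[1+n]≡[i+n]+1 a i))
                          (Loop∞.map γ (a ℤ.+ + i))

  window : ∀ γ a L → IsWindow γ a L → PathN X x₀ x₀
  window γ a L (below , above) =
    fromWalk L (from γ a) (from-walk γ a) (below _ (ℤP.≤-reflexive (ℤP.+-identityʳ a))) (above _ ℤP.≤-refl)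

  at-window : ∀ γ a L w i → i ℕ.≤ L → at X (window γ a L w) i ≡ from γ a i
  at-window γ a L w i i≤L = cong (from γ a) (toℕ-clamp-≤ L i i≤L)

  length : Loop → ℕ
  length γ = ℤ.∣ N₊ γ ℤ.- N₋ γ ∣

  loop-IsWindow : ∀ γ → IsWindow γ (N₋ γ) (length γ)
  loop-IsWindow γ = Loop∞.below γ , λ z le → Loop∞.above γ z (ℤP.≤-trans (j≤i+∣j-i∣ (N₋ γ) (N₊ γ)) le)

  toPath : Loop → PathN X x₀ x₀
  toPath γ = window γ (N₋ γ) (length γ) (loop-IsWindow γ)

  -- the wider window stays at x₀ for d steps, then follows the narrower one
  widen-Reparam : ∀ {γ a L b d M} (w : IsWindow γ a L) (w′ : IsWindow γ b M) →
                  a ≡ b ℤ.+ + d → d ℕ.+ L ℕ.≤ M → Reparam X (window γ b M w′) (window γ a L w)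
  widen-Reparam {γ} {a} {L} {b} {d} {M} w@(below , above) w′ a≡b+d d+L≤M =
    degeneracy-Reparam deg (window γ b M w′) (window γ a L w) (ℕP.m≥n⇒m⊓n≡n L≤M∸d) agree
    where
    s : ℕ → ℕ
    s i = (i ∸ d) ⊓ L
    deg : IsDegeneracy s
    deg = record
      { fix-0 = cong (_⊓ L) (ℕP.0∸n≡0 d)
      ; mono  = λ i≤j → ℕP.⊓-monoˡ-≤ L (ℕP.∸-monoˡ-≤ d i≤j)
      ; step  = λ i → proj₂ (near-⊓ (near-∸ˡ i d) (near-refl L)) }
    L≤M∸d : L ℕ.≤ M ∸ d
    L≤M∸d = subst (ℕ._≤ M ∸ d) (ℕP.m+n∸m≡n d L) (ℕP.∸-monoˡ-≤ d d+L≤M)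
    a+k≡b+[d+k] : ∀ k → a ℤ.+ + k ≡ b ℤ.+ + (d ℕ.+ k)
    a+k≡b+[d+k] k = trans (cong (ℤ._+ + k) a≡b+d) (sym (i+[m+n]≡[i+m]+n b d k))
    agree : ∀ i → i ℕ.≤ M → at X (window γ b M w′) i ≡ at X (window γ a L w) (s i)
    agree i i≤M rewrite at-window γ b M w′ i i≤M | at-window γ a L w (s i) (ℕP.m⊓n≤n (i ∸ d) L)
      with i ℕ.≤? d
    ... | yes i≤d rewrite ℕP.m≤n⇒m∸n≡0 i≤d =
          trans (below _ (subst (b ℤ.+ + i ℤ.≤_) (sym a≡b+d) (i+-mono-≤ b i≤d)))
                (sym (below _ (ℤP.≤-reflexive (ℤP.+-identityʳ a))))
    ... | no  i≰d with (i ∸ d) ℕ.≤? L | ℕP.m+[n∸m]≡n (ℕP.<⇒≤ (ℕP.≰⇒> i≰d))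
    ...   | yes i∸d≤L | d+[i∸d]≡i rewrite ℕP.m≤n⇒m⊓n≡m i∸d≤L =
            cong (γ ⟨_⟩) (sym (trans (a+k≡b+[d+k] (i ∸ d)) (cong (λ k → b ℤ.+ + k) d+[i∸d]≡i)))
    ...   | no  i∸d≰L | d+[i∸d]≡i rewrite ℕP.m≥n⇒m⊓n≡n (ℕP.<⇒≤ (ℕP.≰⇒> i∸d≰L)) =
            trans (above _ (subst (ℤ._≤ b ℤ.+ + i) (sym (a+k≡b+[d+k] L)) (i+-mono-≤ b d+L≤i)))
                  (sym (above _ ℤP.≤-refl))
      where
      d+L≤i : d ℕ.+ L ℕ.≤ i
      d+L≤i = subst (d ℕ.+ L ℕ.≤_) d+[i∸d]≡i (ℕP.+-monoʳ-≤ d (ℕP.<⇒≤ (ℕP.≰⇒> i∸d≰L)))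

  window-SameΠ₁ : ∀ {γ a L a′ L′} (w : IsWindow γ a L) (w′ : IsWindow γ a′ L′) →
                  SameΠ₁ X (window γ a L w) (window γ a′ L′ w′)
  window-SameΠ₁ {γ} {a} {L} {a′} {L′} w w′ =
    Reparam⇒SameΠ₁˘ {q = window γ start size hull} (widen-Reparam {d = d} w hull a≡start+d d+L≤size) ◅◅
    Reparam⇒SameΠ₁ (widen-Reparam {d = d′} w′ hull a′≡start+d′ d′+L′≤size)
    where
    open Hull a L a′ L′
    hull : IsWindow γ start size
    hull = IsWindow-widen {d = d} w a≡start+d d+L≤size

  toPath-resp-ΩEqAdj : ∀ γ σ → ΩEqAdj X γ σ → SameΠ₁ X (toPath γ) (toPath σ)
  toPath-resp-ΩEqAdj γ σ γ≈σ =
    window-SameΠ₁ (loop-IsWindow γ) hullγ ◅◅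
    (inj₁ (refl , λ j → γ≈σ (start ℤ.+ + toℕ j)) ◅ ε) ◅◅
    window-SameΠ₁ hullσ (loop-IsWindow σ)
    where
    open Hull (N₋ γ) (length γ) (N₋ σ) (length σ)
    hullγ : IsWindow γ start size
    hullγ = IsWindow-widen {d = d} (loop-IsWindow γ) a≡start+d d+L≤size
    hullσ : IsWindow σ start size
    hullσ = IsWindow-widen {d = d′} (loop-IsWindow σ) a′≡start+d′ d′+L′≤size

  toPath-resp : ∀ {γ σ : Loop} → SameA₁ X γ σ → SameΠ₁ X (toPath γ) (toPath σ)
  toPath-resp ε                            = ε
  toPath-resp {γ} (_◅_ {j = τ} step steps) = toPath-resp-ΩEqAdj γ τ step ◅◅ toPath-resp steps

  -- Loops from finite paths

  pointwise⇒SameA₁ : ∀ {γ σ : Loop} → (∀ z → γ ⟨ z ⟩ ≡ σ ⟨ z ⟩) → SameA₁ X γ σ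
  pointwise⇒SameA₁ γ≡σ = (λ z → inj₁ (γ≡σ z)) ◅ ε

  SameA₁-sym : ∀ {γ σ : Loop} → SameA₁ X γ σ → SameA₁ X σ γ
  SameA₁-sym = Star.reverse (λ γ≈σ z → EqAdj-sym (γ≈σ z))

  extendℕ : (ℕ → V) → ℤ → V
  extendℕ f (+ i)    = f i
  extendℕ f -[1+ _ ] = x₀

  extend : ∀ f → Walk f → f 0 ≡ x₀ → ∀ L → (∀ i → L ℕ.≤ i → f i ≡ x₀) → Loop
  extend f walk f0 L fL = record
    { γ = extendℕ f ; map = map ; N₋ = 0ℤ ; N₊ = + L ; below = below ; above = above }
    where
    map : ∀ z → EqAdj X (extendℕ f z) (extendℕ f (z ℤ.+ 1ℤ))
    map (+ i)          = subst (λ j → EqAdj X (f i) (f j)) (ℕP.+-comm 1 i) (walk i)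
    map -[1+ 0 ]       = inj₁ (sym f0)
    map -[1+ suc _ ]   = EqAdj-refl
    below : ∀ z → z ℤ.≤ 0ℤ → extendℕ f z ≡ x₀
    below (+ zero)  _             = f0
    below (+ suc _) (ℤ.+≤+ ())
    below -[1+ _ ]  _             = refl
    above : ∀ z → + L ℤ.≤ z → extendℕ f z ≡ x₀
    above (+ i) (ℤ.+≤+ L≤i) = fL i L≤i

  extendℕ-EqAdj : ∀ {f g} → (∀ i → EqAdj X (f i) (g i)) → ∀ z → EqAdj X (extendℕ f z) (extendℕ g z)
  extendℕ-EqAdj f≈g (+ i)    = f≈g i
  extendℕ-EqAdj f≈g -[1+ _ ] = EqAdj-refl

  fromPath : PathN X x₀ x₀ → Loop
  fromPath p = extend (at X p) (at-walk p) (at-zero p) (len p) (at-≥len p)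

  shift : Loop → ℤ → Loop
  shift γ a = record
    { γ     = λ z → γ ⟨ a ℤ.+ z ⟩
    ; map   = λ z → subst (λ y → EqAdj X (γ ⟨ a ℤ.+ z ⟩) (γ ⟨ y ⟩)) (ℤP.+-assoc a z 1ℤ)
                            (Loop∞.map γ (a ℤ.+ z))
    ; N₋    = N₋ γ ℤ.- a
    ; N₊    = N₊ γ ℤ.- a
    ; below = λ z z≤ → Loop∞.below γ _ (subst (a ℤ.+ z ℤ.≤_) (a+[b-a]≡b a (N₋ γ)) (ℤP.+-monoʳ-≤ a z≤))
    ; above = λ z ≤z → Loop∞.above γ _ (subst (ℤ._≤ a ℤ.+ z) (a+[b-a]≡b a (N₊ γ)) (ℤP.+-monoʳ-≤ a ≤z)) }
    where
    a+[b-a]≡b : ∀ a b → a ℤ.+ (b ℤ.- a) ≡ b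
    a+[b-a]≡b a b = sym (j≡i+[j-i] a b)

  shift-ΩEqAdj : ∀ γ a → ΩEqAdj X (shift γ a) (shift γ (a ℤ.+ 1ℤ))
  shift-ΩEqAdj γ a z =
    subst (λ y → EqAdj X (γ ⟨ a ℤ.+ z ⟩) (γ ⟨ y ⟩)) (assoc-comm a z) (Loop∞.map γ (a ℤ.+ z))
    where
    assoc-comm : ∀ a z → (a ℤ.+ z) ℤ.+ 1ℤ ≡ (a ℤ.+ 1ℤ) ℤ.+ z
    assoc-comm = solve-∀

  shift-up : ∀ γ a k → SameA₁ X (shift γ a) (shift γ (a ℤ.+ + k))
  shift-up γ a k = pointwise⇒SameA₁ (λ z → cong (λ b → γ ⟨ b ℤ.+ z ⟩) (sym (ℤP.+-identityʳ a))) ◅◅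
                   chain↑ (λ k → shift γ (a ℤ.+ + k)) step k
    where
    step : ∀ k → ΩEqAdj X (shift γ (a ℤ.+ + k)) (shift γ (a ℤ.+ + suc k))
    step k = subst (λ b → ΩEqAdj X (shift γ (a ℤ.+ + k)) (shift γ b)) (sym (i+[1+n]≡[i+n]+1 a k))
                   (shift-ΩEqAdj γ (a ℤ.+ + k))

  shift-SameA₁ : ∀ γ a → SameA₁ X γ (shift γ a)
  shift-SameA₁ γ a = unshifted ◅◅ to a
    where
    unshifted : SameA₁ X γ (shift γ 0ℤ)
    unshifted = pointwise⇒SameA₁ (λ z → cong (γ ⟨_⟩) (sym (ℤP.+-identityˡ z)))
    to : ∀ a → SameA₁ X (shift γ 0ℤ) (shift γ a)
    to (+ k)    = shift-up γ 0ℤ k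
    to -[1+ k ] = SameA₁-sym (shift-up γ -[1+ k ] (suc k) ◅◅
                    pointwise⇒SameA₁ (λ z → cong (λ b → γ ⟨ b ℤ.+ z ⟩) (ℤP.+-inverseˡ (+ suc k))))

  fromPath-toPath : ∀ γ → SameA₁ X γ (fromPath (toPath γ))
  fromPath-toPath γ = shift-SameA₁ γ (N₋ γ) ◅◅ pointwise⇒SameA₁ agree
    where
    a = N₋ γ
    L = length γ
    w = loop-IsWindow γ
    agree : ∀ z → γ ⟨ a ℤ.+ z ⟩ ≡ extendℕ (at X (toPath γ)) z
    agree -[1+ k ] = IsWindow.below w _ (ℤP.i≤j⇒i-k≤j (+ suc k) ℤP.≤-refl)
    agree (+ i) with i ℕ.≤? L
    ... | yes i≤L = sym (at-window γ a L w i i≤L)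
    ... | no  i≰L = trans (IsWindow.above w _ (i+-mono-≤ a L≤i)) (sym (at-≥len (toPath γ) i L≤i))
      where L≤i = ℕP.<⇒≤ (ℕP.≰⇒> i≰L)

  Reparam⇒SameA₁ : ∀ p′ p → Reparam X p′ p → SameA₁ X (fromPath p′) (fromPath p)
  Reparam⇒SameA₁ (m , P′) p@(n , P) (s , isr , agree) =
    pointwise⇒SameA₁ lazy-m ◅◅ chain↓ H shrink m ◅◅ pointwise⇒SameA₁ lazy-0
    where
    open Lazy (IsReparam⇒IsDegeneracy isr)
    top = IsReparam⇒onℕ-top isr
    h : ℕ → ℕ → V
    h t = at X p ∘ lazy t
    h-zero : ∀ t → h t 0 ≡ x₀
    h-zero t = trans (cong (at X p) (lazy-origin t)) (at-zero p)
    h-end : ∀ t i → m ℕ.≤ i → h t i ≡ x₀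
    h-end t i m≤i = at-≥len p (lazy t i) (subst (ℕ._≤ lazy t i) (top i m≤i) (s≤lazy t i))
    H : ℕ → Loop
    H t = extend (h t) (walk-∘ (at-walk p) (lazy-near-i t)) (h-zero t) m (h-end t)
    shrink : ∀ t → ΩEqAdj X (H (suc t)) (H t)
    shrink t = extendℕ-EqAdj (λ i → walk-near (at-walk p) (near-sym (lazy-near-t t i)))
    lazy-m : ∀ z → extendℕ (at X (m , P′)) z ≡ extendℕ (h m) z
    lazy-m -[1+ _ ] = refl
    lazy-m (+ i) = trans (agree (clamp X m i)) (trans (sym (at-toℕ P (s (clamp X m i)))) reparametrised)
      where
      reparametrised : at X p (onℕ s i) ≡ at X p (lazy m i)
      reparametrised with i ℕ.≤? m
      ... | yes i≤m = cong (at X p) (sym (lazy-≤ i≤m))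
      ... | no  i≰m = trans (at-≥len p (onℕ s i) (ℕP.≤-reflexive (sym (top i m≤i)))) (sym (h-end m i m≤i))
        where m≤i = ℕP.<⇒≤ (ℕP.≰⇒> i≰m)
    lazy-0 : ∀ z → extendℕ (h 0) z ≡ extendℕ (at X p) z
    lazy-0 -[1+ _ ] = refl
    lazy-0 (+ i)    = cong (at X p) (lazy-identity i)

  fromPath-resp-PNStep : ∀ p q → PNStep X p q → SameA₁ X (fromPath p) (fromPath q)
  fromPath-resp-PNStep (n , P) (.n , Q) (inj₁ (refl , P≈Q)) = extendℕ-EqAdj (λ i → P≈Q (clamp X n i)) ◅ ε
  fromPath-resp-PNStep p q (inj₂ (inj₁ r)) = Reparam⇒SameA₁ p q r
  fromPath-resp-PNStep p q (inj₂ (inj₂ r)) = SameA₁-sym (Reparam⇒SameA₁ q p r)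

  fromPath-resp : ∀ {p q} → SameΠ₁ X p q → SameA₁ X (fromPath p) (fromPath q)
  fromPath-resp ε                            = ε
  fromPath-resp {p} (_◅_ {j = r} step steps) = fromPath-resp-PNStep p r step ◅◅ fromPath-resp steps

  toPath-injective : ∀ γ σ → SameΠ₁ X (toPath γ) (toPath σ) → SameA₁ X γ σ
  toPath-injective γ σ same = fromPath-toPath γ ◅◅ fromPath-resp same ◅◅ SameA₁-sym (fromPath-toPath σ)

  toPath-fromPath : ∀ c → SameΠ₁ X (toPath (fromPath c)) c
  toPath-fromPath c = pointwise⇒SameΠ₁ (toPath (fromPath c)) c length-fromPath agree
    where
    length-fromPath : length (fromPath c) ≡ len c
    length-fromPath = cong ℤ.∣_∣ (ℤP.+-identityʳ (+ len c))
    agree : ∀ i → i ℕ.≤ length (fromPath c) → at X (toPath (fromPath c)) i ≡ at X c i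
    agree i i≤L = at-window (fromPath c) 0ℤ (length (fromPath c)) (loop-IsWindow (fromPath c)) i i≤L

  toPath-surjective : ∀ c → ∃[ γ ] SameΠ₁ X (toPath γ) c
  toPath-surjective c = fromPath c , toPath-fromPath c

  toPath-constLoop : SameΠ₁ X (toPath (constLoop X x₀)) (idPath X x₀)
  toPath-constLoop = pointwise⇒SameΠ₁ _ _ refl (λ _ _ → refl)

  -- Concatenation

  module Glue (γ σ : Loop) where

    glue : ℤ → ℤ → ℤ → V
    glue = concat∞ X γ σ

    glue-≤ : ∀ {u w z} → z ℤ.≤ u → glue u w z ≡ γ ⟨ z ⟩
    glue-≤ {u} {w} {z} z≤u with z ℤP.≤? u
    ... | yes _   = refl
    ... | no  z≰u = ⊥-elim (z≰u z≤u)

    glue-≰ : ∀ {u w z} → ¬ z ℤ.≤ u → glue u w z ≡ σ ⟨ z ℤ.- u ℤ.+ w ⟩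
    glue-≰ {u} {w} {z} z≰u with z ℤP.≤? u
    ... | yes z≤u = ⊥-elim (z≰u z≤u)
    ... | no  _   = refl

    glue-windows : ∀ c → IsConcatFin X (toPath γ) (toPath σ) c →
                   ∀ z → glue (N₋ γ ℤ.+ + length γ) (N₋ σ) (N₋ γ ℤ.+ z) ≡ extendℕ (at X c) z
    glue-windows c (len-c , at-c) = agree
      where
      a = N₋ γ
      n = length γ
      v = N₋ σ
      m = length σ
      u = a ℤ.+ + n
      agree : ∀ z → glue u v (a ℤ.+ z) ≡ extendℕ (at X c) z
      agree -[1+ k ] = trans (glue-≤ (ℤP.≤-trans a-k≤a (ℤP.i≤i+j a (+ n)))) (Loop∞.below γ _ a-k≤a)
        where a-k≤a = ℤP.i≤j⇒i-k≤j (+ suc k) ℤP.≤-refl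
      agree (+ i) with i ℕ.≤? n
      ... | yes i≤n rewrite glue-≤ {w = v} (i+-mono-≤ a i≤n) | at-c i (ℕP.≤-trans i≤n (ℕP.m≤m+n n m))
                          | ≤⇒≤ᵇ≡true i≤n =
            sym (at-window γ a n (loop-IsWindow γ) i i≤n)
      ... | no  i≰n = trans (glue-≰ (i≰n ∘ i+m≤i+n⇒m≤n a)) (trans (cong (σ ⟨_⟩) index) in-σ)
        where
        n≤i = ℕP.<⇒≤ (ℕP.≰⇒> i≰n)
        index : a ℤ.+ + i ℤ.- u ℤ.+ v ≡ v ℤ.+ + (i ∸ n)
        index = trans (cong (λ j → a ℤ.+ j ℤ.- u ℤ.+ v) i≡n+[i∸n]) (cancel a (+ n) (+ (i ∸ n)) v)
          where
          cancel : ∀ a x y v → a ℤ.+ (x ℤ.+ y) ℤ.- (a ℤ.+ x) ℤ.+ v ≡ v ℤ.+ y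
          cancel = solve-∀
          i≡n+[i∸n] : + i ≡ + n ℤ.+ + (i ∸ n)
          i≡n+[i∸n] = trans (cong +_ (sym (ℕP.m+[n∸m]≡n n≤i))) (ℤP.pos-+ n (i ∸ n))
        in-σ : σ ⟨ v ℤ.+ + (i ∸ n) ⟩ ≡ at X c i
        in-σ with i ℕ.≤? n ℕ.+ m
        ... | yes i≤n+m rewrite at-c i i≤n+m | ≰⇒≤ᵇ≡false i≰n =
              sym (at-window σ v m (loop-IsWindow σ) (i ∸ n)
                     (subst (i ∸ n ℕ.≤_) (ℕP.m+n∸m≡n n m) (ℕP.∸-monoˡ-≤ n i≤n+m)))
        ... | no  i≰n+m = trans (IsWindow.above (loop-IsWindow σ) _ (i+-mono-≤ v m≤i∸n))
                                (sym (at-≥len c i (subst (ℕ._≤ i) (sym len-c) n+m≤i)))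
          where
          n+m≤i = ℕP.<⇒≤ (ℕP.≰⇒> i≰n+m)
          m≤i∸n : m ℕ.≤ i ∸ n
          m≤i∸n = subst (ℕ._≤ i ∸ n) (ℕP.m+n∸m≡n n m) (ℕP.∸-monoˡ-≤ n n+m≤i)

    -- Since γ is x₀ from M on and σ is x₀ up to N, cutting at any u ≥ M and w ≤ N gives a loop,
    -- and moving a cut by one step is an adjacency in Ω∞.
    module Cuts (M N : ℤ) (γ-above : ∀ z → M ℤ.≤ z → γ ⟨ z ⟩ ≡ x₀)
                (σ-below : ∀ z → z ℤ.≤ N → σ ⟨ z ⟩ ≡ x₀) where
      private
        shifted-suc : ∀ z u w → (z ℤ.+ 1ℤ) ℤ.- u ℤ.+ w ≡ (z ℤ.- u ℤ.+ w) ℤ.+ 1ℤ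
        shifted-suc = solve-∀

        shifted-pred : ∀ z u w → z ℤ.- u ℤ.+ w ≡ (z ℤ.- (u ℤ.+ 1ℤ) ℤ.+ w) ℤ.+ 1ℤ
        shifted-pred = solve-∀

        slide : ∀ z u w → z ℤ.- (u ℤ.+ 1ℤ) ℤ.+ w ≡ z ℤ.- u ℤ.+ (w ℤ.- 1ℤ)
        slide = solve-∀

      glued : ∀ u w → M ℤ.≤ u → w ℤ.≤ N → Loop
      glued u w M≤u w≤N = record
        { γ = glue u w ; map = map ; N₋ = N₋ γ ℤ.⊓ u ; N₊ = u ℤ.⊔ (N₊ σ ℤ.+ u ℤ.- w)
        ; below = below ; above = above }
        where
        map : ∀ z → EqAdj X (glue u w z) (glue u w (z ℤ.+ 1ℤ))
        map z with (z ℤ.+ 1ℤ) ℤP.≤? u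
        ... | yes z+1≤u rewrite glue-≤ {w = w} (ℤP.≤-trans (ℤP.i≤i+j z 1ℤ) z+1≤u) = Loop∞.map γ z
        ... | no  z+1≰u rewrite shifted-suc z u w =
              subst (λ y → EqAdj X y (σ ⟨ c ℤ.+ 1ℤ ⟩)) (sym glue-z) (Loop∞.map σ c)
          where
          c = z ℤ.- u ℤ.+ w
          glue-z : glue u w z ≡ σ ⟨ c ⟩
          glue-z with z ℤP.≤? u
          ... | yes z≤u = trans (γ-above z (ℤP.≤-trans M≤u (i+1≰j⇒j≤i z+1≰u)))
                                (sym (σ-below c (ℤP.≤-trans (i≤j⇒i-j+k≤k w z≤u) w≤N)))
          ... | no  _   = refl
        below : ∀ z → z ℤ.≤ N₋ γ ℤ.⊓ u → glue u w z ≡ x₀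
        below z z≤ =
          trans (glue-≤ (ℤP.≤-trans z≤ (ℤP.i⊓j≤j _ u))) (Loop∞.below γ z (ℤP.≤-trans z≤ (ℤP.i⊓j≤i _ u)))
        above : ∀ z → u ℤ.⊔ (N₊ σ ℤ.+ u ℤ.- w) ℤ.≤ z → glue u w z ≡ x₀
        above z ≤z with z ℤP.≤? u
        ... | yes _ = γ-above z (ℤP.≤-trans M≤u (ℤP.≤-trans (ℤP.i≤i⊔j u _) ≤z))
        ... | no  _ = Loop∞.above σ _ (subst (ℤ._≤ z ℤ.- u ℤ.+ w) (shift-back (N₊ σ) u w)
                        (ℤP.+-monoˡ-≤ w (ℤP.+-monoˡ-≤ (ℤ.- u) (ℤP.≤-trans (ℤP.i≤j⊔i u _) ≤z))))
          where
          shift-back : ∀ a u w → a ℤ.+ u ℤ.- w ℤ.- u ℤ.+ w ≡ a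
          shift-back = solve-∀

      module _ {u w} (M≤u : M ℤ.≤ u) (w≤N : w ℤ.≤ N) where

        glue-stepˡ : ∀ z → EqAdj X (glue u w z) (glue (u ℤ.+ 1ℤ) w z)
        glue-stepˡ z with z ℤP.≤? u
        ... | yes z≤u rewrite glue-≤ {w = w} (ℤP.≤-trans z≤u (ℤP.i≤i+j u 1ℤ)) = EqAdj-refl
        ... | no  z≰u rewrite shifted-pred z u w =
              subst (EqAdj X (σ ⟨ c ℤ.+ 1ℤ ⟩)) (sym glue-z) (EqAdj-sym (Loop∞.map σ c))
          where
          c = z ℤ.- (u ℤ.+ 1ℤ) ℤ.+ w
          glue-z : glue (u ℤ.+ 1ℤ) w z ≡ σ ⟨ c ⟩
          glue-z with z ℤP.≤? (u ℤ.+ 1ℤ)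
          ... | yes z≤u+1 = trans (γ-above z (ℤP.≤-trans M≤u (≰⇒≥ z≰u)))
                                  (sym (σ-below c (ℤP.≤-trans (i≤j⇒i-j+k≤k w z≤u+1) w≤N)))
          ... | no  _     = refl

        glue-slide : ∀ z → glue (u ℤ.+ 1ℤ) w z ≡ glue u (w ℤ.- 1ℤ) z
        glue-slide z with z ℤP.≤? u
        ... | yes z≤u = glue-≤ (ℤP.≤-trans z≤u (ℤP.i≤i+j u 1ℤ))
        ... | no  z≰u with z ℤP.≤? (u ℤ.+ 1ℤ)
        ...   | yes z≤u+1 = trans (γ-above z (ℤP.≤-trans M≤u (≰⇒≥ z≰u)))
                                  (sym (σ-below _ (ℤP.≤-trans slid≤w w≤N)))
          where slid≤w = subst (ℤ._≤ w) (slide z u w) (i≤j⇒i-j+k≤k w z≤u+1)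
        ...   | no  _     = cong (σ ⟨_⟩) (slide z u w)

        glue-stepʳ : ∀ z → EqAdj X (glue u w z) (glue u (w ℤ.- 1ℤ) z)
        glue-stepʳ z = subst (EqAdj X (glue u w z)) (glue-slide z) (glue-stepˡ z)

      private
        M≤M+j : ∀ j → M ℤ.≤ M ℤ.+ + j
        M≤M+j j = ℤP.i≤i+j M (+ j)

        N-k≤N : ∀ k → N ℤ.- + k ℤ.≤ N
        N-k≤N k = ℤP.i≤j⇒i-k≤j (+ k) ℤP.≤-refl

      glued-at : ℕ → ℕ → Loop
      glued-at j k = glued (M ℤ.+ + j) (N ℤ.- + k) (M≤M+j j) (N-k≤N k)

      glued-chain : ∀ j k → SameA₁ X (glued-at 0 0) (glued-at j k)
      glued-chain j k = chain↑ (λ j → glued-at j 0) (λ j → stepˡ j 0) j ◅◅ chain↑ (glued-at j) (stepʳ j) k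
        where
        stepˡ : ∀ j k → ΩEqAdj X (glued-at j k) (glued-at (suc j) k)
        stepˡ j k = subst (λ u → ∀ z → EqAdj X (glue (M ℤ.+ + j) (N ℤ.- + k) z) (glue u (N ℤ.- + k) z))
                          (sym (i+[1+n]≡[i+n]+1 M j)) (glue-stepˡ (M≤M+j j) (N-k≤N k))
        N-k-1≡N-[1+k] : ∀ k → N ℤ.- + k ℤ.- 1ℤ ≡ N ℤ.- + suc k
        N-k-1≡N-[1+k] k = trans (assoc N (+ k)) (cong (λ i → N ℤ.- i) (sym (ℤP.pos-+ 1 k)))
          where
          assoc : ∀ N k → N ℤ.- k ℤ.- 1ℤ ≡ N ℤ.- (1ℤ ℤ.+ k)
          assoc = solve-∀
        stepʳ : ∀ j k → ΩEqAdj X (glued-at j k) (glued-at j (suc k))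
        stepʳ j k = subst (λ w → ∀ z → EqAdj X (glue (M ℤ.+ + j) (N ℤ.- + k) z) (glue (M ℤ.+ + j) w z))
                          (N-k-1≡N-[1+k] k) (glue-stepʳ (M≤M+j j) (N-k≤N k))

  -- τ cuts γ and σ at M and N; slide the cuts to the window ends u and v, then shift by N₋ γ.
  concat-SameA₁ : ∀ γ σ τ → IsConcat∞ X γ σ τ →
                  ∀ c → IsConcatFin X (toPath γ) (toPath σ) c → SameA₁ X τ (fromPath c)
  concat-SameA₁ γ σ τ (M , N , (γ-above , M-least) , (σ-below , N-greatest) , τ≡) c c-concat =
    pointwise⇒SameA₁ τ≡glued-at-0-0 ◅◅ glued-chain Δu Δw ◅◅ pointwise⇒SameA₁ glued-at-Δu-Δw≡glued-u-v ◅◅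
    shift-SameA₁ (glued u v M≤u v≤N) (N₋ γ) ◅◅ pointwise⇒SameA₁ (glue-windows c c-concat)
    where
    open Glue γ σ
    open Cuts M N γ-above σ-below
    u = N₋ γ ℤ.+ + length γ
    v = N₋ σ
    M≤u : M ℤ.≤ u
    M≤u = M-least u (IsWindow.above (loop-IsWindow γ))
    v≤N : v ℤ.≤ N
    v≤N = N-greatest v (Loop∞.below σ)
    Δu = ℤ.∣ u ℤ.- M ∣
    Δw = ℤ.∣ N ℤ.- v ∣
    N-Δw≡v : N ℤ.- + Δw ≡ v
    N-Δw≡v = trans (cong (λ i → i ℤ.- + Δw) (i≤j⇒j≡i+∣j-i∣ v≤N)) (v+k-k≡v v (+ Δw))
      where
      v+k-k≡v : ∀ v k → v ℤ.+ k ℤ.- k ≡ v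
      v+k-k≡v = solve-∀
    τ≡glued-at-0-0 : ∀ z → τ ⟨ z ⟩ ≡ glue (M ℤ.+ + 0) (N ℤ.- + 0) z
    τ≡glued-at-0-0 z =
      trans (τ≡ z) (cong₂ (λ u w → glue u w z) (sym (ℤP.+-identityʳ M)) (sym (ℤP.+-identityʳ N)))
    glued-at-Δu-Δw≡glued-u-v : ∀ z → glue (M ℤ.+ + Δu) (N ℤ.- + Δw) z ≡ glue u v z
    glued-at-Δu-Δw≡glued-u-v z = cong₂ (λ u w → glue u w z) (sym (i≤j⇒j≡i+∣j-i∣ M≤u)) N-Δw≡v

  toPath-concat : ∀ γ σ τ → IsConcat∞ X γ σ τ →
                  ∀ c → IsConcatFin X (toPath γ) (toPath σ) c → SameΠ₁ X (toPath τ) c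
  toPath-concat γ σ τ τ-concat c c-concat =
    toPath-resp (concat-SameA₁ γ σ τ τ-concat c c-concat) ◅◅ toPath-fromPath c

proposition3p5 : (X : Graph) (x₀ : Graph.V X) →
    Σ[ φ ∈ (Loop∞ X x₀ → PathN X x₀ x₀) ]
      IsGroupIso X x₀ φ × (Connected X → IsEquivalenceOfCategories X x₀ φ)
proposition3p5 X x₀ = toPath , isGroupIso , isEquivalence
  where
  open Paths X
  open Loops X x₀
  isGroupIso : IsGroupIso X x₀ toPath
  isGroupIso = record
    { resp = λ _ _ → toPath-resp ; inj = toPath-injective ; surj = toPath-surjective
    ; hom = toPath-concat ; unit = toPath-constLoop }
  isEquivalence : Connected X → IsEquivalenceOfCategories X x₀ toPath
  isEquivalence connected = record
    { F-hom = toPath-concat ; F-id = toPath-constLoop ; F-resp = λ _ _ → toPath-resp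
    ; faithful = toPath-injective ; full = toPath-surjective
    ; essSurj = λ x → let p = connected x₀ x in p , reverse p , reverse-inverse p }
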